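{- Let $\mathscr{F}=(X,I)$ be a quasi-$1$-plane. Then: (1) $I^2$ is an equivalence relation on $X$. (2) For all $a,b\in X$, $aIb$ implies $aI^3b$. (3) $\mathscr{F}$ is connected if and only if it satisfies condition O2: for all $a,b\in X$, $aI^2b$ or $aI^3b$. (4) If $\mathscr{F}$ is connected, then for any element $a\in X$, the subsets $I^2(a)=\{x\in X:aI^2x\}$ and $I^3(a)=\{x\in X:aI^3x\}$ are the only $I^2$-equivalence classes. (5) If $\mathscr{F}$ is connected, then for any element $a\in X$ and any $x,y\in X$ with $xIy$, one of $x$ and $y$ is in $I^2(a)$ and the other is in $I^3(a)$.
   Context: A $1$-frame is a pair $\mathscr{F}=(X,I)$ with $I\subseteq X\times X$. $I^n$ denotes the $n$-fold relational composition of $I$ with itself ($I^0$ is the identity), so $aI^nb$ iff there is a sequence $a=a_0Ia_1I\cdots Ia_n=b$. $I$ is serial if every $a\in X$ has some $b$ with $aIb$. A quasi-$1$-plane is a $1$-frame in which $I$ is serial and symmetric and which satisfies O1: for all $a,b$, $aI^4b$ implies $aI^2b$. Let $I_+=I\cup\{(b,a):aIb\}$. $\mathscr{F}$ is connected if for any two elements there is an $I_+$-path from one to the other (a finite sequence $a_0I_+a_1I_+\cdots I_+a_n$). -}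

module Defs where

open import Data.Nat using (ℕ; zero; suc)
open import Data.Product using (Σ; _×_; _,_)
open import Data.Sum using (_⊎_)
open import Relation.Binary.PropositionalEquality using (_≡_)
open import Relation.Binary.Core using (Rel)
open import Relation.Binary.Construct.Closure.ReflexiveTransitive using (Star)
open import Relation.Binary.Construct.Closure.Symmetric using (SymClosure)
open import Relation.Unary using (Pred)

-- A 1-frame is a carrier X : Set with a binary relation I : Rel X 0ℓ.

_^_ : {X : Set} → Rel X _ → ℕ → Rel X _
(I ^ zero) a b = a ≡ b
(I ^ suc n) a b = Σ _ λ c → I a c × (I ^ n) c b

image : {X : Set} → Rel X _ → ℕ → X → Pred X _
image I n a x = (I ^ n) a x

Serial : {X : Set} → Rel X _ → Set
Serial {X} I = ∀ (a : X) → Σ X λ b → I a b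

Symmetric : {X : Set} → Rel X _ → Set
Symmetric {X} I = ∀ {a b : X} → I a b → I b a

O1 : {X : Set} → Rel X _ → Set
O1 {X} I = ∀ (a b : X) → (I ^ 4) a b → (I ^ 2) a b

O2 : {X : Set} → Rel X _ → Set
O2 {X} I = ∀ (a b : X) → (I ^ 2) a b ⊎ (I ^ 3) a b

record QuasiPlane {X : Set} (I : Rel X _) : Set where
  field
    serial    : Serial I
    symmetric : Symmetric I
    o1        : O1 I

Connected : {X : Set} → Rel X _ → Set
Connected {X} I = ∀ (a b : X) → Star (SymClosure I) a b

-- Since O1 shortens any I-path of length at least 4 by two steps, only the parity of
-- a path matters: I² is transitive, symmetry reverses paths and seriality gives a I² a.
-- Every I₊-path from a therefore ends in I²(a) or I³(a), and these two sets are the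
-- I²-classes of the endpoints at even and odd distance from a.
module Submission where

open import Defs
open import Level using (0ℓ)
open import Data.Nat using (ℕ; zero; suc; _+_)
open import Data.Product using (Σ; _×_; _,_)
open import Data.Sum using (_⊎_; inj₁; inj₂; [_,_]) renaming (map to ⊎-map)
open import Relation.Binary.Core using (Rel)
open import Relation.Binary.Structures using (IsEquivalence)
open import Relation.Unary using (_∈_; _≐_)
open import Function.Bundles using (_⇔_; mk⇔)
open import Relation.Binary.PropositionalEquality using (_≡_; refl)
open import Relation.Binary.Construct.Closure.ReflexiveTransitive using (Star; ε; _◅_)
open import Relation.Binary.Construct.Closure.Symmetric using (SymClosure; fwd; bwd)

module Paths {X : Set} (I : Rel X 0ℓ) where

  ^-++ : ∀ {m n a b c} → (I ^ m) a b → (I ^ n) b c → (I ^ (m + n)) a c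
  ^-++ {zero}  refl        q = q
  ^-++ {suc m} (d , i , p) q = d , i , ^-++ p q

  ^-snoc : ∀ {n a b c} → (I ^ n) a b → I b c → (I ^ suc n) a c
  ^-snoc {zero}  refl        j = _ , j , refl
  ^-snoc {suc n} (d , i , p) j = d , i , ^-snoc p j

  ^⇒Star : ∀ {n a b} → (I ^ n) a b → Star (SymClosure I) a b
  ^⇒Star {zero}  refl        = ε
  ^⇒Star {suc n} (d , i , p) = fwd i ◅ ^⇒Star p

  I²∪I³ : Rel X 0ℓ
  I²∪I³ a b = (I ^ 2) a b ⊎ (I ^ 3) a b

  O2⇒Connected : O2 I → Connected I
  O2⇒Connected o2 a b = [ ^⇒Star , ^⇒Star ] (o2 a b)

  module _ (symmetric : Symmetric I) where

    ^-sym : ∀ {n a b} → (I ^ n) a b → (I ^ n) b a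
    ^-sym {zero}  refl        = refl
    ^-sym {suc n} (d , i , p) = ^-snoc (^-sym p) (symmetric i)

    I⊆I³ : ∀ a b → I a b → (I ^ 3) a b
    I⊆I³ a b i = b , i , a , symmetric i , b , i , refl

    I²-refl : Serial I → ∀ a → (I ^ 2) a a
    I²-refl serial a with serial a
    ... | b , i = b , i , a , symmetric i , refl

  module _ (o1 : O1 I) where

    ^-shorten : ∀ n {a b} → (I ^ (4 + n)) a b → (I ^ (2 + n)) a b
    ^-shorten zero    p           = o1 _ _ p
    ^-shorten (suc n) (d , i , p) = d , i , ^-shorten n p

    I²-trans : ∀ {a b c} → (I ^ 2) a b → (I ^ 2) b c → (I ^ 2) a c
    I²-trans p q = ^-shorten 0 (^-++ p q)

    I²∪I³-stepˡ : ∀ {a c b} → I a c → I²∪I³ c b → I²∪I³ a b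
    I²∪I³-stepˡ i (inj₁ p) = inj₂ (_ , i , p)
    I²∪I³-stepˡ i (inj₂ p) = inj₁ (o1 _ _ (_ , i , p))

module QuasiPlaneProperties {X : Set} {I : Rel X 0ℓ} (Q : QuasiPlane I) where
  open QuasiPlane Q
  open Paths I

  I²-isEquivalence : IsEquivalence (I ^ 2)
  I²-isEquivalence = record
    { refl  = I²-refl symmetric serial _
    ; sym   = ^-sym symmetric
    ; trans = I²-trans o1
    }

  Star⇒I²∪I³ : ∀ {a b} → Star (SymClosure I) a b → I²∪I³ a b
  Star⇒I²∪I³ ε           = inj₁ (I²-refl symmetric serial _)
  Star⇒I²∪I³ (fwd i ◅ s) = I²∪I³-stepˡ o1 i (Star⇒I²∪I³ s)
  Star⇒I²∪I³ (bwd i ◅ s) = I²∪I³-stepˡ o1 (symmetric i) (Star⇒I²∪I³ s)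

  Connected⇒O2 : Connected I → O2 I
  Connected⇒O2 connected a b = Star⇒I²∪I³ (connected a b)

  image²≐image² : ∀ {a x} → (I ^ 2) a x → image I 2 x ≐ image I 2 a
  image²≐image² p = I²-trans o1 p , I²-trans o1 (^-sym symmetric p)

  image²≐image³ : ∀ {a x} → (I ^ 3) a x → image I 2 x ≐ image I 3 a
  image²≐image³ p =
      (λ q → ^-shorten o1 1 (^-++ p q))
    , (λ q → ^-shorten o1 0 (^-shorten o1 2 (^-++ (^-sym symmetric p) q)))

  I-edge-switches-parity : ∀ {a x y} → I²∪I³ a x → I x y →
    (x ∈ image I 2 a × y ∈ image I 3 a) ⊎ (y ∈ image I 2 a × x ∈ image I 3 a)
  I-edge-switches-parity (inj₁ p) i = inj₁ (p , ^-snoc p i)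
  I-edge-switches-parity (inj₂ p) i = inj₂ (o1 _ _ (^-snoc p i) , p)

theorem3p2 : {X : Set} (I : Rel X _) → QuasiPlane I →
    IsEquivalence (I ^ 2)
    × (∀ (a b : X) → I a b → (I ^ 3) a b)
    × (Connected I ⇔ O2 I)
    × (Connected I → ∀ (a : X) →
         -- every I²-equivalence class is I²(a) or I³(a) ...
         (∀ (x : X) → (image I 2 x ≐ image I 2 a) ⊎ (image I 2 x ≐ image I 3 a))
         -- ... and both I²(a) and I³(a) are I²-equivalence classes
         × (Σ X λ x → image I 2 x ≐ image I 2 a)
         × (Σ X λ x → image I 2 x ≐ image I 3 a))
    × (Connected I → ∀ (a x y : X) → I x y →
         (x ∈ image I 2 a × y ∈ image I 3 a) ⊎ (y ∈ image I 2 a × x ∈ image I 3 a))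
theorem3p2 I Q =
    I²-isEquivalence
  , I⊆I³ symmetric
  , mk⇔ Connected⇒O2 O2⇒Connected
  , (λ connected a →
        (λ x → ⊎-map image²≐image² image²≐image³ (Connected⇒O2 connected a x))
      , (a , image²≐image² (I²-refl symmetric serial a))
      , (let (b , i) = serial a in b , image²≐image³ (I⊆I³ symmetric a b i)))
  , (λ connected a x y → I-edge-switches-parity (Connected⇒O2 connected a x))
  where
    open QuasiPlane Q
    open Paths I
    open QuasiPlaneProperties Q
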